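{- Let $G=(V,E)$ be a hypergraph and $e\in E$. Then \[ I(G,x)=I(G_{\times e},x)-x^{|e|-1}\cdot I(G_{/e},x)+\bigl(x^{|e|-1}-x\bigr)\cdot I(G_{ -V(e)},x). \]
   Context: A hypergraph $G=(V,E)$ consists of a finite vertex set $V$ and a finite multiset $E$ of non-empty subsets of $V$ (edges). A set $W\subseteq V$ is independent in $G$ if no edge $f\in E$ satisfies $f\subseteq W$; the independence polynomial is $I(G,x)=\sum_{W\subseteq V,\ W\text{ independent}}x^{|W|}$. $G_{\times e}$ (subdivision) is obtained by removing $e$ and adding a new vertex $d$ together with the edges $\{v,d\}$ for every $v\in e$. $G_{/e}$ (contraction) is obtained by removing $e$ and identifying all vertices of $e$ into a single new vertex $w$ (every other edge containing vertices of $e$ has them replaced by $w$). $G_{ -V(e)}$ is obtained by deleting all vertices of $e$ together with all edges containing at least one of them. -}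

module Defs where

open import Level using (Level)
open import Data.Bool using (Bool; true; false; if_then_else_; not; _∧_)
open import Data.Nat using (ℕ; zero; suc; _∸_)
open import Data.Fin using (Fin)
open import Data.Fin.Subset using (Subset; _⊆_; _∈_; _∩_; _─_; ⁅_⁆; ∣_∣; Nonempty; ⊥; ⊤)
open import Data.Fin.Subset.Properties using (_⊆?_; _∈?_; nonempty?)
open import Data.Vec using (Vec; _∷_; [])
open import Data.List using (List; []; _∷_; map; filter; _++_; length; lookup; removeAt; allFin; foldr)
open import Data.List.Relation.Unary.All using (All)
open import Data.Product using (_×_)
open import Relation.Nullary using (does)
open import Algebra.Bundles using (CommutativeRing)

-- A (raw) hypergraph whose vertex set V is a subset of the ambient
-- finite set Fin n, with a finite multiset (list) of edges.
record Hypergraph (n : ℕ) : Set where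
  constructor hg
  field
    vertices : Subset n
    edges    : List (Subset n)
open Hypergraph public

WellFormed : ∀ {n} → Hypergraph n → Set
WellFormed G = All (λ f → Nonempty f × f ⊆ vertices G) (edges G)

EdgeIx : ∀ {n} → Hypergraph n → Set
EdgeIx G = Fin (length (edges G))

edgeAt : ∀ {n} (G : Hypergraph n) → EdgeIx G → Subset n
edgeAt G i = lookup (edges G) i

-- Embedding into ambient Fin (suc n): old vertex j ↦ suc j,
-- the new vertex is zero.
lift : ∀ {n} → Subset n → Subset (suc n)
lift s = false ∷ s

newV : ∀ {n} → Subset (suc n)
newV = true ∷ ⊥

members : ∀ {n} → Subset n → List (Fin n)
members e = filter (λ v → v ∈? e) (allFin _)

-- G_{×e}: remove e, add new vertex d and edges {v,d} for v ∈ e.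
subdivide : ∀ {n} (G : Hypergraph n) → EdgeIx G → Hypergraph (suc n)
subdivide G i =
  hg (true ∷ vertices G)
     (map lift (removeAt (edges G) i) ++ map (λ v → true ∷ ⁅ v ⁆) (members (edgeAt G i)))

-- G_{/e}: remove e, identify all vertices of e into a new vertex w.
contract : ∀ {n} (G : Hypergraph n) → EdgeIx G → Hypergraph (suc n)
contract G i =
  hg (true ∷ (vertices G ─ e))
     (map (λ f → if does (nonempty? (f ∩ e)) then true ∷ (f ─ e) else lift f)
          (removeAt (edges G) i))
  where e = edgeAt G i

-- G_{-V(e)}: delete the vertices of e and all edges meeting them.
deleteV : ∀ {n} (G : Hypergraph n) → EdgeIx G → Hypergraph n
deleteV G i =
  hg (vertices G ─ e)
     (filter (λ f → Relation.Nullary.¬? (nonempty? (f ∩ e))) (edges G))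
  where e = edgeAt G i

allSubsets : (n : ℕ) → List (Subset n)
allSubsets zero = [] ∷ []
allSubsets (suc n) = map (false ∷_) (allSubsets n) ++ map (true ∷_) (allSubsets n)

allB : ∀ {A : Set} → (A → Bool) → List A → Bool
allB p [] = true
allB p (a ∷ as) = p a ∧ allB p as

isIndependent : ∀ {n} → Hypergraph n → Subset n → Bool
isIndependent G W = does (W ⊆? vertices G) ∧ allB (λ f → not (does (f ⊆? W))) (edges G)

module _ {c ℓ : Level} (R : CommutativeRing c ℓ) where
  open CommutativeRing R

  pow : Carrier → ℕ → Carrier
  pow x zero = 1#
  pow x (suc k) = x * pow x k

  -- I(G, x) evaluated at x in the commutative ring R:
  -- sum over independent W ⊆ V of x^|W|.
  indepPoly : ∀ {n} → Hypergraph n → Carrier → Carrier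
  indepPoly {n} G x =
    foldr (λ W acc → (if isIndependent G W then pow x ∣ W ∣ else 0#) + acc) 0#
          (allSubsets n)

-- Sum I(G, x) and the three polynomials on the right over subsets W of the old vertices, splitting each
-- subset of an enlarged vertex set according to whether it contains the new vertex. Write b(W) for
-- independence of W in G − e (e deleted, vertices kept). Then W is independent in G iff b(W) and e ⊄ W;
-- in G_{×e}, W is independent iff b(W), and W + d iff b(W) and W ∩ e = ∅; in G_{−V(e)}, W is independent
-- iff b(W) and W ∩ e = ∅, and so is W in G_{/e}; finally (W ∖ e) + w is independent in G_{/e} iff b(W) and
-- e ⊆ W, where W ↦ W △ e reindexes the subsets bijectively. With C = Σ_{W ⊇ e, b(W)} x^{|W|−|e|+1} this gives
--   I(G_{×e}) = I(G − e) + x I(G_{−V(e)}),   I(G_{/e}) = I(G_{−V(e)}) + C,   I(G) = I(G − e) − x^{|e|−1} C,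
-- and eliminating I(G − e) and C yields the identity. Non-emptiness of e is used for |e| ≥ 1 and to drop e
-- itself from G_{−V(e)}.

module Submission where

open import Defs
open import Level using (Level)
open import Algebra.Bundles using (CommutativeRing; CommutativeMonoid)
open import Data.Bool using (Bool; true; false; not; _∧_; _∨_; _xor_; if_then_else_)
open import Data.Bool.Properties
  using (∨-zeroʳ; ∧-zeroʳ; ∧-identityʳ; ∧-assoc; ∧-commutativeMonoid; not-involutive)
open import Data.Nat using (ℕ; zero; suc; _∸_; _≤_) renaming (_+_ to _+ℕ_)
import Data.Nat.Properties as ℕ
open import Data.Fin using (Fin; zero; suc)
open import Data.Fin.Properties using (any?)
open import Data.Fin.Subset using (Subset; _⊆_; _∈_; _∩_; _─_; ⁅_⁆; ∣_∣; Nonempty)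
open import Data.Fin.Subset.Properties
  using (_⊆?_; _∈?_; nonempty?; drop-there; x∈⁅x⁆; ∩-idem; x∈⁅y⁆⇒x≡y; ∣⁅x⁆∣≡1; p⊆q⇒∣p∣≤∣q∣)
open import Data.List using (List; []; _∷_; map; filter; _++_; foldr; length; removeAt; allFin)
  renaming (lookup to lookupL)
open import Data.List.Properties using (map-tabulate)
open import Data.List.Membership.Propositional.Properties using (∈-lookup)
import Data.List.Relation.Unary.All as All
open import Data.Product using (_×_; _,_; proj₁; proj₂; map₂)
open import Data.Vec using (_∷_; []; zipWith; there)
open import Function using (_∘_; mk⇔)
open import Relation.Nullary using (does)
open import Relation.Nullary.Decidable using (does-⇔; dec-true; ¬?)
open import Relation.Unary using (Pred; Decidable)
open import Relation.Binary.PropositionalEquality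
  using (_≡_; refl; sym; trans; cong; cong₂; subst; module ≡-Reasoning)
open import Algebra.Properties.CommutativeSemigroup (CommutativeMonoid.commutativeSemigroup ∧-commutativeMonoid)
  using (x∙yz≈y∙xz; x∙yz≈xz∙y)

private variable
  n : ℕ

infix 4.5 _⊆ᵇ_
infixr 7 _△_

_⊆ᵇ_ : Subset n → Subset n → Bool
p ⊆ᵇ q = does (p ⊆? q)

nonemptyᵇ : Subset n → Bool
nonemptyᵇ []      = false
nonemptyᵇ (b ∷ p) = b ∨ nonemptyᵇ p

_△_ : Subset n → Subset n → Subset n
_△_ = zipWith _xor_

does-nonempty? : (p : Subset n) → does (nonempty? p) ≡ nonemptyᵇ p
does-nonempty? []          = refl
does-nonempty? (true ∷ p)  = refl
does-nonempty? (false ∷ p) =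
  trans (does-⇔ (mk⇔ (map₂ drop-there) (map₂ there)) (any? (λ x → suc x ∈? false ∷ p)) (nonempty? p))
        (does-nonempty? p)

x∈p⇒⁅x⁆⊆p : {x : Fin n} {p : Subset n} → x ∈ p → ⁅ x ⁆ ⊆ p
x∈p⇒⁅x⁆⊆p {x = x} {p} x∈p y∈⁅x⁆ = subst (_∈ p) (sym (x∈⁅y⁆⇒x≡y x y∈⁅x⁆)) x∈p

⁅x⁆⊆ᵇp≡x∈?p : (x : Fin n) (p : Subset n) → ⁅ x ⁆ ⊆ᵇ p ≡ does (x ∈? p)
⁅x⁆⊆ᵇp≡x∈?p x p =
  does-⇔ (mk⇔ (λ ⁅x⁆⊆p → ⁅x⁆⊆p (x∈⁅x⁆ x)) x∈p⇒⁅x⁆⊆p) (⁅ x ⁆ ⊆? p) (x ∈? p)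

nonempty⇒1≤∣p∣ : {p : Subset n} → Nonempty p → 1 ≤ ∣ p ∣
nonempty⇒1≤∣p∣ (x , x∈p) = subst (_≤ _) (∣⁅x⁆∣≡1 x) (p⊆q⇒∣p∣≤∣q∣ (x∈p⇒⁅x⁆⊆p x∈p))

∸1+suc≡+ : ∀ {k} m → 1 ≤ k → k ∸ 1 +ℕ suc m ≡ m +ℕ k
∸1+suc≡+ {suc k} m _ = trans (ℕ.+-suc k m) (trans (cong suc (ℕ.+-comm k m)) (sym (ℕ.+-suc m k)))

⊆ᵇ-─ : (w v e : Subset n) → w ⊆ᵇ v ─ e ≡ (w ⊆ᵇ v) ∧ not (nonemptyᵇ (w ∩ e))
⊆ᵇ-─ []          []          []          = refl
⊆ᵇ-─ (false ∷ w) (_ ∷ v)     (_ ∷ e)     = ⊆ᵇ-─ w v e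
⊆ᵇ-─ (true ∷ w)  (true ∷ v)  (true ∷ e)  = sym (∧-zeroʳ (w ⊆ᵇ v))
⊆ᵇ-─ (true ∷ w)  (false ∷ v) (true ∷ e)  = refl
⊆ᵇ-─ (true ∷ w)  (true ∷ v)  (false ∷ e) = ⊆ᵇ-─ w v e
⊆ᵇ-─ (true ∷ w)  (false ∷ v) (false ∷ e) = refl

─-⊆ᵇ-△ : (f w e : Subset n) → e ⊆ᵇ w ≡ true → f ─ e ⊆ᵇ w △ e ≡ f ⊆ᵇ w
─-⊆ᵇ-△ []          []          []          _ = refl
─-⊆ᵇ-△ (_ ∷ f)     (false ∷ w) (true ∷ e)  ()
─-⊆ᵇ-△ (true ∷ f)  (true ∷ w)  (true ∷ e)  h = ─-⊆ᵇ-△ f w e h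
─-⊆ᵇ-△ (false ∷ f) (true ∷ w)  (true ∷ e)  h = ─-⊆ᵇ-△ f w e h
─-⊆ᵇ-△ (false ∷ f) (_ ∷ w)     (false ∷ e) h = ─-⊆ᵇ-△ f w e h
─-⊆ᵇ-△ (true ∷ f)  (true ∷ w)  (false ∷ e) h = ─-⊆ᵇ-△ f w e h
─-⊆ᵇ-△ (true ∷ f)  (false ∷ w) (false ∷ e) h = refl

⊆ᵇ-△-disjoint : (f w e : Subset n) → nonemptyᵇ (f ∩ e) ≡ false → f ⊆ᵇ w △ e ≡ f ⊆ᵇ w
⊆ᵇ-△-disjoint []          []          []          _ = refl
⊆ᵇ-△-disjoint (false ∷ f) (_ ∷ w)     (_ ∷ e)     h = ⊆ᵇ-△-disjoint f w e h
⊆ᵇ-△-disjoint (true ∷ f)  (_ ∷ w)     (true ∷ e)  ()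
⊆ᵇ-△-disjoint (true ∷ f)  (true ∷ w)  (false ∷ e) h = ⊆ᵇ-△-disjoint f w e h
⊆ᵇ-△-disjoint (true ∷ f)  (false ∷ w) (false ∷ e) h = refl

△-⊆ᵇ-─ : (w v e : Subset n) → e ⊆ᵇ v ≡ true → w △ e ⊆ᵇ v ─ e ≡ (w ⊆ᵇ v) ∧ (e ⊆ᵇ w)
△-⊆ᵇ-─ []          []          []          _ = refl
△-⊆ᵇ-─ (_ ∷ w)     (false ∷ v) (true ∷ e)  ()
△-⊆ᵇ-─ (true ∷ w)  (true ∷ v)  (true ∷ e)  h = △-⊆ᵇ-─ w v e h
△-⊆ᵇ-─ (false ∷ w) (true ∷ v)  (true ∷ e)  h = sym (∧-zeroʳ (w ⊆ᵇ v))
△-⊆ᵇ-─ (false ∷ w) (_ ∷ v)     (false ∷ e) h = △-⊆ᵇ-─ w v e h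
△-⊆ᵇ-─ (true ∷ w)  (true ∷ v)  (false ∷ e) h = △-⊆ᵇ-─ w v e h
△-⊆ᵇ-─ (true ∷ w)  (false ∷ v) (false ∷ e) h = refl

∣△∣+∣e∣ : (w e : Subset n) → e ⊆ᵇ w ≡ true → ∣ w △ e ∣ +ℕ ∣ e ∣ ≡ ∣ w ∣
∣△∣+∣e∣ []          []          _ = refl
∣△∣+∣e∣ (false ∷ w) (true ∷ e)  ()
∣△∣+∣e∣ (true ∷ w)  (true ∷ e)  h = trans (ℕ.+-suc ∣ w △ e ∣ ∣ e ∣) (cong suc (∣△∣+∣e∣ w e h))
∣△∣+∣e∣ (true ∷ w)  (false ∷ e) h = cong suc (∣△∣+∣e∣ w e h)
∣△∣+∣e∣ (false ∷ w) (false ∷ e) h = ∣△∣+∣e∣ w e h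

module _ {A : Set} where

  allB-++ : (p : A → Bool) (xs ys : List A) → allB p (xs ++ ys) ≡ allB p xs ∧ allB p ys
  allB-++ p []       ys = refl
  allB-++ p (x ∷ xs) ys = trans (cong (p x ∧_) (allB-++ p xs ys)) (sym (∧-assoc (p x) _ _))

  allB-map : {B : Set} (p : B → Bool) (f : A → B) (xs : List A) →
             allB p (map f xs) ≡ allB (p ∘ f) xs
  allB-map p f []       = refl
  allB-map p f (x ∷ xs) = cong (p (f x) ∧_) (allB-map p f xs)

  allB-cong : {p q : A → Bool} → (∀ a → p a ≡ q a) → (xs : List A) → allB p xs ≡ allB q xs
  allB-cong p≗q []       = refl
  allB-cong p≗q (x ∷ xs) = cong₂ _∧_ (p≗q x) (allB-cong p≗q xs)

  allB-true : (xs : List A) → allB (λ _ → true) xs ≡ true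
  allB-true []       = refl
  allB-true (x ∷ xs) = allB-true xs

  allB-filter : {ℓ : Level} {P : Pred A ℓ} (P? : Decidable P) (p : A → Bool) (xs : List A) →
                allB p (filter P? xs) ≡ allB (λ a → not (does (P? a)) ∨ p a) xs
  allB-filter P? p []       = refl
  allB-filter P? p (x ∷ xs) with does (P? x)
  ... | true  = cong (p x ∧_) (allB-filter P? p xs)
  ... | false = allB-filter P? p xs

  allB-removeAt : (p : A → Bool) (xs : List A) (i : Fin (length xs)) →
                  allB p xs ≡ p (lookupL xs i) ∧ allB p (removeAt xs i)
  allB-removeAt p (x ∷ xs) zero    = refl
  allB-removeAt p (x ∷ xs) (suc i) =
    trans (cong (p x ∧_) (allB-removeAt p xs i))
          (x∙yz≈y∙xz (p x) (p (lookupL xs i)) (allB p (removeAt xs i)))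

allB-allFin-suc : (p : Fin (suc n) → Bool) →
                  allB p (allFin (suc n)) ≡ p zero ∧ allB (p ∘ suc) (allFin n)
allB-allFin-suc {n} p = cong (p zero ∧_)
  (trans (cong (allB p) (sym (map-tabulate {n = n} (λ i → i) suc))) (allB-map p suc (allFin n)))

disjointAt : Subset n → Subset n → Fin n → Bool
disjointAt w e v = not (does (v ∈? e)) ∨ not (does (v ∈? w))

allFin-disjoint : (w e : Subset n) → allB (disjointAt w e) (allFin n) ≡ not (nonemptyᵇ (w ∩ e))
allFin-disjoint []          []          = refl
allFin-disjoint (true ∷ w)  (true ∷ e)  = allB-allFin-suc (disjointAt (true ∷ w) (true ∷ e))
allFin-disjoint (true ∷ w)  (false ∷ e) =
  trans (allB-allFin-suc (disjointAt (true ∷ w) (false ∷ e))) (allFin-disjoint w e)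
allFin-disjoint (false ∷ w) (true ∷ e)  =
  trans (allB-allFin-suc (disjointAt (false ∷ w) (true ∷ e))) (allFin-disjoint w e)
allFin-disjoint (false ∷ w) (false ∷ e) =
  trans (allB-allFin-suc (disjointAt (false ∷ w) (false ∷ e))) (allFin-disjoint w e)

edgeFree : List (Subset n) → Subset n → Bool
edgeFree fs w = allB (λ f → not (f ⊆ᵇ w)) fs

∧-guarded-cong : ∀ a c {l l′} → (c ≡ true → l ≡ l′) → (a ∧ c) ∧ l ≡ (a ∧ l′) ∧ c
∧-guarded-cong false c     _    = refl
∧-guarded-cong true  true  l≡l′ = trans (l≡l′ refl) (sym (∧-identityʳ _))
∧-guarded-cong true  false _    = sym (∧-zeroʳ _)

⊆ᵇ-disjoint : (f w e : Subset n) → f ⊆ᵇ w ≡ true →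
              not (nonemptyᵇ (w ∩ e)) ≡ true → not (nonemptyᵇ (f ∩ e)) ≡ true
⊆ᵇ-disjoint []          []          []          _ _ = refl
⊆ᵇ-disjoint (_ ∷ f)     (true ∷ w)  (true ∷ e)  _ ()
⊆ᵇ-disjoint (true ∷ f)  (false ∷ w) (_ ∷ e)     () _
⊆ᵇ-disjoint (true ∷ f)  (true ∷ w)  (false ∷ e) h d = ⊆ᵇ-disjoint f w e h d
⊆ᵇ-disjoint (false ∷ f) (true ∷ w)  (false ∷ e) h d = ⊆ᵇ-disjoint f w e h d
⊆ᵇ-disjoint (false ∷ f) (false ∷ w) (_ ∷ e)     h d = ⊆ᵇ-disjoint f w e h d

edgeFree-disjoint : (w e : Subset n) (fs : List (Subset n)) → not (nonemptyᵇ (w ∩ e)) ≡ true →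
                    allB (λ f → nonemptyᵇ (f ∩ e) ∨ not (f ⊆ᵇ w)) fs ≡ edgeFree fs w
edgeFree-disjoint w e fs w∩e≡∅ = allB-cong meets-or-avoids fs
  where
  meets-or-avoids : ∀ f → nonemptyᵇ (f ∩ e) ∨ not (f ⊆ᵇ w) ≡ not (f ⊆ᵇ w)
  meets-or-avoids f with f ⊆ᵇ w in f⊆w
  ... | false = ∨-zeroʳ _
  ... | true with nonemptyᵇ (f ∩ e) | ⊆ᵇ-disjoint f w e f⊆w w∩e≡∅
  ...   | false | _  = refl
  ...   | true  | ()

independent-disjoint : (v e w : Subset n) (fs : List (Subset n)) →
  (w ⊆ᵇ v ─ e) ∧ allB (λ f → nonemptyᵇ (f ∩ e) ∨ not (f ⊆ᵇ w)) fs
    ≡ isIndependent (hg v fs) w ∧ not (nonemptyᵇ (w ∩ e))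
independent-disjoint v e w fs =
  trans (cong (_∧ _) (⊆ᵇ-─ w v e)) (∧-guarded-cong (w ⊆ᵇ v) _ (edgeFree-disjoint w e fs))

spokes : Subset n → List (Subset (suc n))
spokes e = map (λ v → true ∷ ⁅ v ⁆) (members e)

edgeFree-spokes-outside : (w e : Subset n) → edgeFree (spokes e) (false ∷ w) ≡ true
edgeFree-spokes-outside w e = trans (allB-map _ _ (members e)) (allB-true (members e))

edgeFree-spokes-inside : (w e : Subset n) → edgeFree (spokes e) (true ∷ w) ≡ not (nonemptyᵇ (w ∩ e))
edgeFree-spokes-inside {n} w e = begin
  edgeFree (spokes e) (true ∷ w)
    ≡⟨ allB-map _ _ (members e) ⟩
  allB (λ v → not (⁅ v ⁆ ⊆ᵇ w)) (members e)
    ≡⟨ allB-cong (λ v → cong not (⁅x⁆⊆ᵇp≡x∈?p v w)) (members e) ⟩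
  allB (λ v → not (does (v ∈? w))) (members e)
    ≡⟨ allB-filter (_∈? e) _ (allFin n) ⟩
  allB (disjointAt w e) (allFin n)
    ≡⟨ allFin-disjoint w e ⟩
  not (nonemptyᵇ (w ∩ e)) ∎
  where open ≡-Reasoning

contractEdge : Subset n → Subset n → Subset (suc n)
contractEdge e f = if does (nonempty? (f ∩ e)) then true ∷ (f ─ e) else lift f

contractEdge-outside : (e w f : Subset n) →
  not (contractEdge e f ⊆ᵇ false ∷ w) ≡ nonemptyᵇ (f ∩ e) ∨ not (f ⊆ᵇ w)
contractEdge-outside e w f with does (nonempty? (f ∩ e)) | does-nonempty? (f ∩ e)
... | true  | f∩e≢∅ = cong (_∨ not (f ⊆ᵇ w)) f∩e≢∅
... | false | f∩e≡∅ = cong (_∨ not (f ⊆ᵇ w)) f∩e≡∅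

contractEdge-inside : (e w f : Subset n) → e ⊆ᵇ w ≡ true → contractEdge e f ⊆ᵇ true ∷ w △ e ≡ f ⊆ᵇ w
contractEdge-inside e w f e⊆w with does (nonempty? (f ∩ e)) | does-nonempty? (f ∩ e)
... | true  | _     = ─-⊆ᵇ-△ f w e e⊆w
... | false | f∩e≡∅ = ⊆ᵇ-△-disjoint f w e (sym f∩e≡∅)

removeEdge : (G : Hypergraph n) → EdgeIx G → Hypergraph n
removeEdge G i = hg (vertices G) (removeAt (edges G) i)

module _ (G : Hypergraph n) (i : EdgeIx G) (w : Subset n) where
  private
    e V : Subset n
    e = edgeAt G i
    V = vertices G

    rest : List (Subset n)
    rest = removeAt (edges G) i

  independent-removeEdge : isIndependent G w ≡ isIndependent (removeEdge G i) w ∧ not (e ⊆ᵇ w)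
  independent-removeEdge =
    trans (cong ((w ⊆ᵇ V) ∧_) (allB-removeAt _ (edges G) i)) (x∙yz≈xz∙y (w ⊆ᵇ V) _ _)

  independent-subdivide-outside :
    isIndependent (subdivide G i) (false ∷ w) ≡ isIndependent (removeEdge G i) w
  independent-subdivide-outside = cong ((w ⊆ᵇ V) ∧_) (begin
    edgeFree (map lift rest ++ spokes e) (false ∷ w)
      ≡⟨ allB-++ _ (map lift rest) (spokes e) ⟩
    edgeFree (map lift rest) (false ∷ w) ∧ edgeFree (spokes e) (false ∷ w)
      ≡⟨ cong₂ _∧_ (allB-map _ lift rest) (edgeFree-spokes-outside w e) ⟩
    edgeFree rest w ∧ true
      ≡⟨ ∧-identityʳ _ ⟩
    edgeFree rest w ∎)
    where open ≡-Reasoning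

  independent-subdivide-inside :
    isIndependent (subdivide G i) (true ∷ w) ≡ isIndependent (removeEdge G i) w ∧ not (nonemptyᵇ (w ∩ e))
  independent-subdivide-inside =
    trans (cong ((w ⊆ᵇ V) ∧_) (trans (allB-++ _ (map lift rest) (spokes e))
                                     (cong₂ _∧_ (allB-map _ lift rest) (edgeFree-spokes-inside w e))))
          (sym (∧-assoc (w ⊆ᵇ V) _ _))

  independent-contract-outside :
    isIndependent (contract G i) (false ∷ w) ≡ isIndependent (removeEdge G i) w ∧ not (nonemptyᵇ (w ∩ e))
  independent-contract-outside =
    trans (cong ((w ⊆ᵇ V ─ e) ∧_) (trans (allB-map _ (contractEdge e) rest)
                                          (allB-cong (contractEdge-outside e w) rest)))
          (independent-disjoint V e w rest)

  independent-contract-inside : e ⊆ᵇ V ≡ true →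
    isIndependent (contract G i) (true ∷ w △ e) ≡ isIndependent (removeEdge G i) w ∧ (e ⊆ᵇ w)
  independent-contract-inside e⊆V =
    trans (cong₂ _∧_ (△-⊆ᵇ-─ w V e e⊆V) (allB-map _ (contractEdge e) rest))
          (∧-guarded-cong (w ⊆ᵇ V) (e ⊆ᵇ w)
            (λ e⊆w → allB-cong (λ f → cong not (contractEdge-inside e w f e⊆w)) rest))

  independent-deleteV : Nonempty e →
    isIndependent (deleteV G i) w ≡ isIndependent (removeEdge G i) w ∧ not (nonemptyᵇ (w ∩ e))
  independent-deleteV e≢∅ =
    trans (cong ((w ⊆ᵇ V ─ e) ∧_) edges-meeting-e-dropped) (independent-disjoint V e w rest)
    where
    e-meets-itself : does (nonempty? (e ∩ e)) ≡ true
    e-meets-itself = dec-true (nonempty? (e ∩ e)) (subst Nonempty (sym (∩-idem e)) e≢∅)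

    edges-meeting-e-dropped : edgeFree (filter (λ f → ¬? (nonempty? (f ∩ e))) (edges G)) w
                              ≡ allB (λ f → nonemptyᵇ (f ∩ e) ∨ not (f ⊆ᵇ w)) rest
    edges-meeting-e-dropped =
      trans (allB-filter (λ f → ¬? (nonempty? (f ∩ e))) _ (edges G))
     (trans (allB-removeAt _ (edges G) i)
            (cong₂ _∧_ (cong (λ b → not (not b) ∨ not (e ⊆ᵇ w)) e-meets-itself)
                       (allB-cong (λ f → cong (_∨ not (f ⊆ᵇ w))
                                    (trans (not-involutive _) (does-nonempty? (f ∩ e)))) rest)))

module _ {c ℓ : Level} (R : CommutativeRing c ℓ) where
  open CommutativeRing R renaming (refl to ≈-refl; sym to ≈-sym; trans to ≈-trans)
  open import Algebra.Properties.Ring ring using (-0#≈0#; -‿distribˡ-*)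
  open import Algebra.Properties.AbelianGroup +-abelianGroup using (⁻¹-∙-comm; ⁻¹-anti-homo‿-)
  open import Algebra.Properties.CommutativeSemigroup
    (CommutativeMonoid.commutativeSemigroup +-commutativeMonoid) using (interchange)
  open import Relation.Binary.Reasoning.Setoid setoid

  sumOver : {A : Set} → List A → (A → Carrier) → Carrier
  sumOver xs f = foldr (λ a acc → f a + acc) 0# xs

  module _ {A : Set} where

    sumOver-++ : (xs ys : List A) (f : A → Carrier) →
                 sumOver (xs ++ ys) f ≈ sumOver xs f + sumOver ys f
    sumOver-++ []       ys f = ≈-sym (+-identityˡ _)
    sumOver-++ (x ∷ xs) ys f = ≈-trans (+-congˡ (sumOver-++ xs ys f)) (≈-sym (+-assoc _ _ _))

    sumOver-map : {B : Set} (g : A → B) (xs : List A) (f : B → Carrier) →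
                  sumOver (map g xs) f ≡ sumOver xs (f ∘ g)
    sumOver-map g []       f = refl
    sumOver-map g (x ∷ xs) f = cong (f (g x) +_) (sumOver-map g xs f)

    sumOver-cong : (xs : List A) {f g : A → Carrier} → (∀ a → f a ≈ g a) → sumOver xs f ≈ sumOver xs g
    sumOver-cong []       f≈g = ≈-refl
    sumOver-cong (x ∷ xs) f≈g = +-cong (f≈g x) (sumOver-cong xs f≈g)

    sumOver-+ : (xs : List A) (f g : A → Carrier) →
                sumOver xs (λ a → f a + g a) ≈ sumOver xs f + sumOver xs g
    sumOver-+ []       f g = ≈-sym (+-identityˡ 0#)
    sumOver-+ (x ∷ xs) f g = ≈-trans (+-congˡ (sumOver-+ xs f g)) (interchange _ _ _ _)

    sumOver-*ˡ : (xs : List A) (k : Carrier) (f : A → Carrier) →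
                 sumOver xs (λ a → k * f a) ≈ k * sumOver xs f
    sumOver-*ˡ []       k f = ≈-sym (zeroʳ k)
    sumOver-*ˡ (x ∷ xs) k f = ≈-trans (+-congˡ (sumOver-*ˡ xs k f)) (≈-sym (distribˡ k _ _))

    sumOver-neg : (xs : List A) (f : A → Carrier) → sumOver xs (λ a → - f a) ≈ - sumOver xs f
    sumOver-neg []       f = ≈-sym -0#≈0#
    sumOver-neg (x ∷ xs) f = ≈-trans (+-congˡ (sumOver-neg xs f)) (⁻¹-∙-comm _ _)

  sumSubsets : (n : ℕ) → (Subset n → Carrier) → Carrier
  sumSubsets n = sumOver (allSubsets n)

  sumSubsets-suc : (n : ℕ) (f : Subset (suc n) → Carrier) →
    sumSubsets (suc n) f ≈ sumSubsets n (f ∘ (false ∷_)) + sumSubsets n (f ∘ (true ∷_))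
  sumSubsets-suc n f =
    ≈-trans (sumOver-++ (map (false ∷_) (allSubsets n)) (map (true ∷_) (allSubsets n)) f)
          (+-cong (reflexive (sumOver-map (false ∷_) (allSubsets n) f))
                  (reflexive (sumOver-map (true ∷_) (allSubsets n) f)))

  sumSubsets-△ : (n : ℕ) (e : Subset n) (f : Subset n → Carrier) →
                 sumSubsets n (λ w → f (w △ e)) ≈ sumSubsets n f
  sumSubsets-△ zero    []          f = ≈-refl
  sumSubsets-△ (suc n) (false ∷ e) f = begin
    sumSubsets (suc n) (λ w → f (w △ (false ∷ e)))
      ≈⟨ sumSubsets-suc n _ ⟩
    sumSubsets n (λ w → f (false ∷ w △ e)) + sumSubsets n (λ w → f (true ∷ w △ e))
      ≈⟨ +-cong (sumSubsets-△ n e (f ∘ (false ∷_))) (sumSubsets-△ n e (f ∘ (true ∷_))) ⟩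
    sumSubsets n (f ∘ (false ∷_)) + sumSubsets n (f ∘ (true ∷_))
      ≈⟨ sumSubsets-suc n f ⟨
    sumSubsets (suc n) f ∎
  sumSubsets-△ (suc n) (true ∷ e)  f = begin
    sumSubsets (suc n) (λ w → f (w △ (true ∷ e)))
      ≈⟨ sumSubsets-suc n _ ⟩
    sumSubsets n (λ w → f (true ∷ w △ e)) + sumSubsets n (λ w → f (false ∷ w △ e))
      ≈⟨ +-cong (sumSubsets-△ n e (f ∘ (true ∷_))) (sumSubsets-△ n e (f ∘ (false ∷_))) ⟩
    sumSubsets n (f ∘ (true ∷_)) + sumSubsets n (f ∘ (false ∷_))
      ≈⟨ +-comm _ _ ⟩
    sumSubsets n (f ∘ (false ∷_)) + sumSubsets n (f ∘ (true ∷_))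
      ≈⟨ sumSubsets-suc n f ⟨
    sumSubsets (suc n) f ∎

  pow-+ : (x : Carrier) (a b : ℕ) → pow R x a * pow R x b ≈ pow R x (a +ℕ b)
  pow-+ x zero    b = *-identityˡ _
  pow-+ x (suc a) b = ≈-trans (*-assoc _ _ _) (*-congˡ (pow-+ x a b))

  if-*ˡ : (b : Bool) (y z : Carrier) → (if b then y * z else 0#) ≈ y * (if b then z else 0#)
  if-*ˡ true  y z = ≈-refl
  if-*ˡ false y z = ≈-sym (zeroʳ y)

  x-0#≈x : (x : Carrier) → x - 0# ≈ x
  x-0#≈x x = ≈-trans (+-congˡ -0#≈0#) (+-identityʳ x)

  if-∧-not : (b s : Bool) (y z : Carrier) → (s ≡ true → z ≈ y) →
    (if b ∧ not s then y else 0#) ≈ (if b then y else 0#) - (if b ∧ s then z else 0#)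
  if-∧-not false s     y z _   = ≈-sym (x-0#≈x 0#)
  if-∧-not true  false y z _   = ≈-sym (x-0#≈x y)
  if-∧-not true  true  y z z≈y = ≈-sym (≈-trans (+-congˡ (-‿cong (z≈y refl))) (-‿inverseʳ y))

  deletion-contraction-identity : (a b c p x : Carrier) →
    a - p * c ≈ ((a + x * b) - p * (b + c)) + (p - x) * b
  deletion-contraction-identity a b c p x = ≈-sym (begin
    ((a + x * b) - p * (b + c)) + (p - x) * b
      ≈⟨ +-cong (+-congˡ (-‿cong (distribˡ p b c))) (distribʳ b p (- x)) ⟩
    ((a + x * b) - (p * b + p * c)) + (p * b + - x * b)
      ≈⟨ +-congˡ (+-congˡ (-‿distribˡ-* x b)) ⟨
    ((a + x * b) - (p * b + p * c)) + (p * b - x * b)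
      ≈⟨ cancel a (x * b) (p * b) (p * c) ⟩
    a - p * c ∎)
    where
    cancel : ∀ a u v w → ((a + u) - (v + w)) + (v - u) ≈ a - w
    cancel a u v w = begin
      ((a + u) - (v + w)) + (v - u)      ≈⟨ +-congʳ (+-congˡ (-‿cong (+-comm v w))) ⟩
      ((a + u) - (w + v)) + (v - u)      ≈⟨ +-congʳ (+-congˡ (⁻¹-∙-comm w v)) ⟨
      ((a + u) + (- w - v)) + (v - u)    ≈⟨ +-congʳ (interchange a u (- w) (- v)) ⟩
      ((a - w) + (u - v)) + (v - u)      ≈⟨ +-assoc _ _ _ ⟩
      (a - w) + ((u - v) + (v - u))      ≈⟨ +-congˡ (+-congˡ (⁻¹-anti-homo‿- u v)) ⟨
      (a - w) + ((u - v) - (u - v))      ≈⟨ +-congˡ (-‿inverseʳ (u - v)) ⟩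
      (a - w) + 0#                       ≈⟨ +-identityʳ (a - w) ⟩
      a - w                              ∎

  -- indepPoly R G x unfolds to sumSubsets n (weight G x).
  weight : {n : ℕ} → Hypergraph n → Carrier → Subset n → Carrier
  weight G x w = if isIndependent G w then pow R x ∣ w ∣ else 0#

  if-cong : {b b′ : Bool} (y : Carrier) → b ≡ b′ → (if b then y else 0#) ≈ (if b′ then y else 0#)
  if-cong y b≡b′ = reflexive (cong (λ b → if b then y else 0#) b≡b′)

module Splitting {c ℓ : Level} (R : CommutativeRing c ℓ) {n : ℕ} (G : Hypergraph n)
                 (wf : WellFormed G) (i : EdgeIx G) (x : CommutativeRing.Carrier R) where
  open CommutativeRing R renaming (refl to ≈-refl; sym to ≈-sym; trans to ≈-trans)
  open import Relation.Binary.Reasoning.Setoid setoid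

  private
    e : Subset n
    e = edgeAt G i

    e-wellFormed : Nonempty e × e ⊆ vertices G
    e-wellFormed = All.lookup wf (∈-lookup i)

    ω : {m : ℕ} → Hypergraph m → Subset m → Carrier
    ω H = weight R H x

    ∑ : (Subset n → Carrier) → Carrier
    ∑ = sumSubsets R n

    ∑-cong : {f g : Subset n → Carrier} → (∀ w → f w ≈ g w) → ∑ f ≈ ∑ g
    ∑-cong = sumOver-cong R (allSubsets n)

  p : Carrier
  p = pow R x (∣ e ∣ ∸ 1)

  -- For e ⊆ w, the subset true ∷ w △ e is w with e collapsed to the new vertex.
  contractedAt : Subset n → Carrier
  contractedAt w = ω (contract G i) (true ∷ w △ e)

  p*x*x^∣w△e∣≈x^∣w∣ : (w : Subset n) → e ⊆ᵇ w ≡ true → p * (x * pow R x ∣ w △ e ∣) ≈ pow R x ∣ w ∣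
  p*x*x^∣w△e∣≈x^∣w∣ w e⊆w =
    ≈-trans (pow-+ R x (∣ e ∣ ∸ 1) (suc ∣ w △ e ∣))
            (reflexive (cong (pow R x) (trans (∸1+suc≡+ ∣ w △ e ∣ (nonempty⇒1≤∣p∣ (proj₁ e-wellFormed)))
                                              (∣△∣+∣e∣ w e e⊆w))))

  indepPoly-subdivide :
    indepPoly R (subdivide G i) x ≈ indepPoly R (removeEdge G i) x + x * indepPoly R (deleteV G i) x
  indepPoly-subdivide = begin
    sumSubsets R (suc n) (ω (subdivide G i))
      ≈⟨ sumSubsets-suc R n _ ⟩
    ∑ (λ w → ω (subdivide G i) (false ∷ w)) + ∑ (λ w → ω (subdivide G i) (true ∷ w))
      ≈⟨ +-cong (∑-cong outside) (∑-cong inside) ⟩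
    ∑ (ω (removeEdge G i)) + ∑ (λ w → x * ω (deleteV G i) w)
      ≈⟨ +-congˡ (sumOver-*ˡ R (allSubsets n) x _) ⟩
    ∑ (ω (removeEdge G i)) + x * ∑ (ω (deleteV G i)) ∎
    where
    outside : ∀ w → ω (subdivide G i) (false ∷ w) ≈ ω (removeEdge G i) w
    outside w = if-cong R _ (independent-subdivide-outside G i w)

    inside : ∀ w → ω (subdivide G i) (true ∷ w) ≈ x * ω (deleteV G i) w
    inside w = ≈-trans (if-cong R _ (independent-subdivide-inside G i w))
              (≈-trans (if-*ˡ R _ x _)
                       (*-congˡ (if-cong R _ (sym (independent-deleteV G i w (proj₁ e-wellFormed))))))

  indepPoly-contract : indepPoly R (contract G i) x ≈ indepPoly R (deleteV G i) x + ∑ contractedAt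
  indepPoly-contract = begin
    sumSubsets R (suc n) (ω (contract G i))
      ≈⟨ sumSubsets-suc R n _ ⟩
    ∑ (λ w → ω (contract G i) (false ∷ w)) + ∑ (λ w → ω (contract G i) (true ∷ w))
      ≈⟨ +-cong (∑-cong outside) (sumSubsets-△ R n e _) ⟨
    ∑ (ω (deleteV G i)) + ∑ contractedAt ∎
    where
    outside : ∀ w → ω (deleteV G i) w ≈ ω (contract G i) (false ∷ w)
    outside w = if-cong R _ (trans (independent-deleteV G i w (proj₁ e-wellFormed))
                                   (sym (independent-contract-outside G i w)))

  indepPoly-removeEdge : indepPoly R G x ≈ indepPoly R (removeEdge G i) x - p * ∑ contractedAt
  indepPoly-removeEdge = begin
    ∑ (ω G)
      ≈⟨ ∑-cong pointwise ⟩
    ∑ (λ w → ω (removeEdge G i) w + - (p * contractedAt w))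
      ≈⟨ sumOver-+ R (allSubsets n) _ _ ⟩
    ∑ (ω (removeEdge G i)) + ∑ (λ w → - (p * contractedAt w))
      ≈⟨ +-congˡ (≈-trans (sumOver-neg R (allSubsets n) _) (-‿cong (sumOver-*ˡ R (allSubsets n) p _))) ⟩
    ∑ (ω (removeEdge G i)) - p * ∑ contractedAt ∎
    where
    e⊆V : e ⊆ᵇ vertices G ≡ true
    e⊆V = dec-true (e ⊆? vertices G) (proj₂ e-wellFormed)

    pointwise : ∀ w → ω G w ≈ ω (removeEdge G i) w - p * contractedAt w
    pointwise w = ≈-trans (if-cong R _ (independent-removeEdge G i w))
                 (≈-trans (if-∧-not R _ (e ⊆ᵇ w) _ _ (p*x*x^∣w△e∣≈x^∣w∣ w))
                          (+-congˡ (-‿cong (≈-trans (if-*ˡ R _ p _)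
                            (*-congˡ (if-cong R _ (sym (independent-contract-inside G i w e⊆V))))))))

mainTheorem11 : ∀ {c ℓ : Level} (R : CommutativeRing c ℓ) {n : ℕ} (G : Hypergraph n)
                  → WellFormed G → (e : EdgeIx G) → (x : CommutativeRing.Carrier R)
                  → let open CommutativeRing R
                        I = indepPoly R
                        k = ∣ edgeAt G e ∣ ∸ 1
                    in I G x ≈ (I (subdivide G e) x - pow R x k * I (contract G e) x)
                                + (pow R x k - x) * I (deleteV G e) x
mainTheorem11 R {n} G wf i x = begin
  I G
    ≈⟨ indepPoly-removeEdge ⟩
  I (removeEdge G i) - p * C
    ≈⟨ deletion-contraction-identity R _ (I (deleteV G i)) C p x ⟩
  ((I (removeEdge G i) + x * I (deleteV G i)) - p * (I (deleteV G i) + C)) + (p - x) * I (deleteV G i)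
    ≈⟨ +-congʳ (+-cong indepPoly-subdivide (-‿cong (*-congˡ indepPoly-contract))) ⟨
  (I (subdivide G i) - p * I (contract G i)) + (p - x) * I (deleteV G i) ∎
  where
  open CommutativeRing R hiding (refl; sym; trans)
  open Splitting R G wf i x
  open import Relation.Binary.Reasoning.Setoid setoid

  I : {m : ℕ} → Hypergraph m → Carrier
  I H = indepPoly R H x

  C : Carrier
  C = sumSubsets R n contractedAt
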